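{- Let $M$ be a binary matrix such that there do not exist three distinct rows $r_a,r_b,r_c$ whose sets $S_a,S_b,S_c$ are pairwise intersecting and satisfy either (H1) $S_a\cap S_b\cap S_c=\emptyset$ or (H2) none of $S_a,S_b,S_c$ is contained in the union of the other two. Let $c_p,c_q$ be two columns of $M$. Then every induced cycle in the graph $G'=G(M)[vert(c_p)\cup vert(c_q)]$ has length at most $4$.
   Context: For a binary matrix $M$ with rows $r_1,\dots,r_m$ and columns $c_1,\dots,c_n$: $S_i=\{j : M_{ij}=1\}$; the derived graph $G(M)$ has vertex set $\{v_1,\dots,v_m\}$ and an edge $\{v_i,v_j\}$ ($i\ne j$) whenever some column $c_k$ has $M_{ik}=M_{jk}=1$; $vert(c_k)=\{v_i : M_{ik}=1\}$. $G[X]$ denotes the subgraph induced on $X$. Sets are pairwise intersecting if every two have nonempty intersection. -}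

module Defs where

open import Data.Nat using (ℕ; zero; suc; _≤_)
open import Data.Fin using (Fin; toℕ)
open import Data.Bool using (Bool; true)
open import Data.Product using (Σ; _×_; ∃)
open import Data.Sum using (_⊎_)
open import Data.Empty using (⊥)
open import Relation.Nullary using (¬_)
open import Relation.Binary.PropositionalEquality using (_≡_; _≢_)
open import Function.Definitions using (Injective)

BinMatrix : ℕ → ℕ → Set
BinMatrix m n = Fin m → Fin n → Bool

_∈S[_]_ : ∀ {m n} → Fin n → BinMatrix m n → Fin m → Set
k ∈S[ M ] i = M i k ≡ true

Intersect : ∀ {m n} → BinMatrix m n → Fin m → Fin m → Set
Intersect {n = n} M a b = Σ (Fin n) λ k → (k ∈S[ M ] a) × (k ∈S[ M ] b)

PairwiseIntersecting : ∀ {m n} → BinMatrix m n → Fin m → Fin m → Fin m → Set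
PairwiseIntersecting M a b c = Intersect M a b × Intersect M a c × Intersect M b c

H1 : ∀ {m n} → BinMatrix m n → Fin m → Fin m → Fin m → Set
H1 {n = n} M a b c = (k : Fin n) → ¬ ((k ∈S[ M ] a) × (k ∈S[ M ] b) × (k ∈S[ M ] c))

NotInUnion : ∀ {m n} → BinMatrix m n → Fin m → Fin m → Fin m → Set
NotInUnion {n = n} M a b c =
  Σ (Fin n) λ k → (k ∈S[ M ] a) × ¬ (k ∈S[ M ] b) × ¬ (k ∈S[ M ] c)

H2 : ∀ {m n} → BinMatrix m n → Fin m → Fin m → Fin m → Set
H2 M a b c = NotInUnion M a b c × NotInUnion M b a c × NotInUnion M c a b

NoBadTriple : ∀ {m n} → BinMatrix m n → Set
NoBadTriple {m} M = (a b c : Fin m) → a ≢ b → a ≢ c → b ≢ c →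
  PairwiseIntersecting M a b c → ¬ (H1 M a b c ⊎ H2 M a b c)

-- Edge {v_i, v_j} of G(M): i ≠ j and some column has a 1 in both rows.
Adj : ∀ {m n} → BinMatrix m n → Fin m → Fin m → Set
Adj M i j = i ≢ j × Intersect M i j

InVert2 : ∀ {m n} → BinMatrix m n → Fin n → Fin n → Fin m → Set
InVert2 M p q i = (p ∈S[ M ] i) ⊎ (q ∈S[ M ] i)

CycNeighbours : (L : ℕ) → Fin L → Fin L → Set
CycNeighbours L i j =
  (suc (toℕ i) ≡ toℕ j) ⊎ (suc (toℕ j) ≡ toℕ i) ⊎
  ((toℕ i ≡ 0) × (suc (toℕ j) ≡ L)) ⊎ ((toℕ j ≡ 0) × (suc (toℕ i) ≡ L))

record IsInducedCycle {m n} (M : BinMatrix m n) (X : Fin m → Set)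
                      (L : ℕ) (f : Fin L → Fin m) : Set where
  field
    length≥3 : 3 ≤ L
    injective : Injective _≡_ _≡_ f
    inX : (i : Fin L) → X (f i)
    adj⇒nb : (i j : Fin L) → Adj M (f i) (f j) → CycNeighbours L i j
    nb⇒adj : (i j : Fin L) → CycNeighbours L i j → Adj M (f i) (f j)

module Submission where

-- Every row of G' = G(M)[vert(c_p) ∪ vert(c_q)] contains column c_p or
-- column c_q, so G' is covered by the two cliques vert(c_p) and vert(c_q).
-- Colour each cycle vertex by the column it is known to contain.  Two
-- distinct vertices of the same colour share a column and are therefore
-- adjacent, so in an induced cycle they must be consecutive.
--
-- In a cycle v₀ v₁ … v_{L-1} with L ≥ 5, the pairs (v₀,v₂), (v₂,v₄),
-- (v₄,v₁), (v₁,v₃), (v₃,v₀) are pairwise non-consecutive and form a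
-- closed walk of odd length 5.  An odd closed walk cannot be properly
-- 2-coloured, so one of these pairs is monochromatic, a contradiction.
--
-- These combine to
-- rule out induced cycles of length ≥ 5.

open import Defs
open import Data.Bool using (Bool; true; false; _≟_)
open import Data.Fin using (Fin; toℕ; #_)
open import Data.Nat using (ℕ; suc; _+_; _≤_; _≤?_)
open import Data.Nat.Properties
  using (≤-trans; ≤-reflexive; n≤1+n; <⇒≤; <⇒≱; 1+n≰n; n≮0; ≰⇒>; m≤n⇒∃[o]m+o≡n)
open import Data.Product using (_,_; _×_)
open import Data.Sum using (_⊎_; inj₁; inj₂; [_,_])
open import Data.Empty using (⊥; ⊥-elim)
open import Function using (const)
open import Relation.Nullary using (¬_; yes; no; contradiction)
open import Relation.Nullary.Decidable using (True; toWitness)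
open import Relation.Binary.PropositionalEquality using (_≡_; _≢_; refl; sym; trans)

two-flips : (a b c : Bool) → a ≢ b → b ≢ c → a ≡ c
two-flips false false _     a≢b _   = contradiction refl a≢b
two-flips true  true  _     a≢b _   = contradiction refl a≢b
two-flips _     false false _   b≢c = contradiction refl b≢c
two-flips _     true  true  _   b≢c = contradiction refl b≢c
two-flips false true  false _   _   = refl
two-flips true  false true  _   _   = refl

pentagon-monochromatic : (a b c d e : Bool) →
  a ≡ b ⊎ b ≡ c ⊎ c ≡ d ⊎ d ≡ e ⊎ e ≡ a
pentagon-monochromatic a b c d e with a ≟ b | b ≟ c | c ≟ d | d ≟ e
... | yes a≡b | _       | _       | _       = inj₁ a≡b
... | no _    | yes b≡c | _       | _       = inj₂ (inj₁ b≡c)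
... | no _    | no _    | yes c≡d | _       = inj₂ (inj₂ (inj₁ c≡d))
... | no _    | no _    | no _    | yes d≡e = inj₂ (inj₂ (inj₂ (inj₁ d≡e)))
... | no a≢b  | no b≢c  | no c≢d  | no d≢e  =
  inj₂ (inj₂ (inj₂ (inj₂ (sym (trans (two-flips a b c a≢b b≢c) (two-flips c d e c≢d d≢e))))))

side : {A B : Set} → A ⊎ B → Bool
side = [ const true , const false ]

same-side⇒intersect : ∀ {m n} (M : BinMatrix m n) (p q : Fin n) {r s : Fin m}
  (x : InVert2 M p q r) (y : InVert2 M p q s) → side x ≡ side y → Intersect M r s
same-side⇒intersect M p q (inj₁ p∈r) (inj₁ p∈s) _  = p , p∈r , p∈s
same-side⇒intersect M p q (inj₂ q∈r) (inj₂ q∈s) _  = q , q∈r , q∈s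
same-side⇒intersect M p q (inj₁ _)   (inj₂ _)   ()
same-side⇒intersect M p q (inj₂ _)   (inj₁ _)   ()

apart⇒¬neighbours : ∀ {L} (i j : Fin L) → 2 + toℕ i ≤ toℕ j →
  ¬ (toℕ i ≡ 0 × suc (toℕ j) ≡ L) → ¬ CycNeighbours L i j
apart⇒¬neighbours i j gap _ (inj₁ i+1≡j) = 1+n≰n (≤-trans gap (≤-reflexive (sym i+1≡j)))
apart⇒¬neighbours i j gap _ (inj₂ (inj₁ j+1≡i)) =
  <⇒≱ (≤-reflexive j+1≡i) (<⇒≤ (≤-trans (n≤1+n _) gap))
apart⇒¬neighbours i j gap ¬wrap (inj₂ (inj₂ (inj₁ wrap))) = ¬wrap wrap
apart⇒¬neighbours i j gap _ (inj₂ (inj₂ (inj₂ (j≡0 , _)))) =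
  n≮0 (≤-trans (≤-trans (n≤1+n _) gap) (≤-reflexive j≡0))

intersect⇒neighbours : ∀ {m n} {M : BinMatrix m n} {X : Fin m → Set} {L}
  {f : Fin L → Fin m} → IsInducedCycle M X L f →
  (i j : Fin L) → i ≢ j → Intersect M (f i) (f j) → CycNeighbours L i j
intersect⇒neighbours C i j i≢j shared = adj⇒nb i j ((λ fi≡fj → i≢j (injective fi≡fj)) , shared)
  where open IsInducedCycle C

no-long-induced-cycle : ∀ {m n} (M : BinMatrix m n) (p q : Fin n) (k : ℕ)
  (f : Fin (5 + k) → Fin m) → ¬ IsInducedCycle M (InVert2 M p q) (5 + k) f
no-long-induced-cycle M p q k f C =
  monochromatic-pair
    (pentagon-monochromatic (colour (# 0)) (colour (# 2)) (colour (# 4)) (colour (# 1)) (colour (# 3)))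
  where
  open IsInducedCycle C

  colour : Fin (5 + k) → Bool
  colour i = side (inX i)

  clash : (i j : Fin (5 + k)) → i ≢ j → ¬ (toℕ i ≡ 0 × suc (toℕ j) ≡ 5 + k) →
          {gap : True (2 + toℕ i ≤? toℕ j)} → colour i ≡ colour j → ⊥
  clash i j i≢j ¬wrap {gap} same =
    apart⇒¬neighbours i j (toWitness gap) ¬wrap
      (intersect⇒neighbours C i j i≢j (same-side⇒intersect M p q (inX i) (inX j) same))

  monochromatic-pair :
    colour (# 0) ≡ colour (# 2) ⊎ colour (# 2) ≡ colour (# 4) ⊎ colour (# 4) ≡ colour (# 1) ⊎
    colour (# 1) ≡ colour (# 3) ⊎ colour (# 3) ≡ colour (# 0) → ⊥
  monochromatic-pair (inj₁ c₀≡c₂)                      = clash (# 0) (# 2) (λ ()) (λ { (_ , ()) }) c₀≡c₂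
  monochromatic-pair (inj₂ (inj₁ c₂≡c₄))               = clash (# 2) (# 4) (λ ()) (λ { (() , _) }) c₂≡c₄
  monochromatic-pair (inj₂ (inj₂ (inj₁ c₄≡c₁)))        = clash (# 1) (# 4) (λ ()) (λ { (() , _) }) (sym c₄≡c₁)
  monochromatic-pair (inj₂ (inj₂ (inj₂ (inj₁ c₁≡c₃)))) = clash (# 1) (# 3) (λ ()) (λ { (() , _) }) c₁≡c₃
  monochromatic-pair (inj₂ (inj₂ (inj₂ (inj₂ c₃≡c₀)))) = clash (# 0) (# 3) (λ ()) (λ { (_ , ()) }) (sym c₃≡c₀)

lemma5 : (m n : ℕ) (M : BinMatrix m n) → NoBadTriple M →
    (p q : Fin n) → (L : ℕ) (f : Fin L → Fin m) →
    IsInducedCycle M (InVert2 M p q) L f → L ≤ 4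
lemma5 m n M _ p q L f C with L ≤? 4
... | yes L≤4 = L≤4
... | no L≰4 with m≤n⇒∃[o]m+o≡n (≰⇒> L≰4)
...   | k , refl = ⊥-elim (no-long-induced-cycle M p q k f C)
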